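{- Let $G$ be a ONE-ONE-LQ instance in which a stable matching $M_s$ is feasible, let $s=|M_s|$, and let $G'$ be the instance obtained by the marking construction described in the context. If $M'$ is a feasible, relaxed stable matching in $G'$, then $M'$ is a feasible, relaxed stable matching in $G$.
   Context: ONE-ONE-LQ instance: bipartite graph $G=(\mathcal{A}\cup\mathcal{B},E)$ of agents and resources, each vertex with a strict preference order over its neighbours ($\succ_u$), each resource with upper-quota $1$ and lower-quota in $\{0,1\}$ (LQ resource if lower-quota $1$). Matching: each vertex in at most one edge; $M(v)$ partner or $\bot$ (least preferred). Feasible: every LQ resource matched. Blocking pair $(a,b)\in E\setminus M$: $b\succ_a M(a)$ and $a\succ_b M(b)$; stable: no blocking pair. Relaxed stable: every agent $a$ in a blocking pair is matched and $M(a)$ is an LQ resource. $\ell(v)$ = length of $v$'s list. Construction: let $X_A$ (resp. $X_B$) be the agents (resp. resources) matched in $M_s$. For every vertex $v\in X_A\cup X_B$, mark the $\min(2s+1,\ell(v))$ most preferred edges incident to $v$. $G'$ is the ONE-ONE-LQ instance formed by the marked edges and their endpoints, with the same quotas and preference lists of $G$ restricted to neighbours in $G'$. -}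

module Defs where

open import Data.Nat using (ℕ; zero; suc; _+_; _*_)
open import Data.Fin using (Fin; zero; suc)
open import Data.Fin.Properties using (_≟_)
open import Data.Bool using (Bool; true; false; _∧_; _∨_)
open import Data.Maybe using (Maybe; just; nothing; is-just)
open import Data.List using (List; []; _∷_; _++_; take; filterᵇ; allFin)
open import Data.Bool.ListAction using (any)
open import Data.List.Membership.Propositional using (_∈_)
open import Data.List.Relation.Unary.Unique.Propositional using (Unique)
open import Data.Product using (Σ; ∃; ∃₂; _×_; _,_)
open import Data.Sum using (_⊎_)
open import Relation.Nullary using (¬_; does)
open import Relation.Binary.PropositionalEquality using (_≡_; _≢_)
import Data.List.Membership.DecPropositional as DecMem

-- Each vertex has a preference list (most preferred first); the list
-- order is the strict preference order.  lq b ≡ true iff b is an LQ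
-- resource (lower quota 1); all upper quotas are 1.
record Instance (nA nB : ℕ) : Set where
  field
    prefA : Fin nA → List (Fin nB)
    prefB : Fin nB → List (Fin nA)
    lq    : Fin nB → Bool
open Instance public

record WellFormed {nA nB : ℕ} (G : Instance nA nB) : Set where
  field
    uniqA : ∀ a → Unique (prefA G a)
    uniqB : ∀ b → Unique (prefB G b)
    symAB : ∀ a b → b ∈ prefA G a → a ∈ prefB G b
    symBA : ∀ a b → a ∈ prefB G b → b ∈ prefA G a

Edge : ∀ {nA nB} → Instance nA nB → Fin nA → Fin nB → Set
Edge G a b = (b ∈ prefA G a) × (a ∈ prefB G b)

Before : ∀ {X : Set} → List X → X → X → Set
Before {X} l x y = ∃₂ λ (xs ys : List X) → (l ≡ xs ++ (x ∷ ys)) × (y ∈ ys)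

Matching : ℕ → ℕ → Set
Matching nA nB = Fin nA → Maybe (Fin nB)

IsMatching : ∀ {nA nB} → Instance nA nB → Matching nA nB → Set
IsMatching {nA} {nB} G M =
  (∀ (a : Fin nA) (b : Fin nB) → M a ≡ just b → Edge G a b) ×
  (∀ (a a' : Fin nA) (b : Fin nB) → M a ≡ just b → M a' ≡ just b → a ≡ a')

PrefA : ∀ {nA nB} → Instance nA nB → Matching nA nB → Fin nA → Fin nB → Set
PrefA G M a b =
  (M a ≡ nothing) ⊎ (∃ λ b' → (M a ≡ just b') × Before (prefA G a) b b')

PrefB : ∀ {nA nB} → Instance nA nB → Matching nA nB → Fin nB → Fin nA → Set
PrefB {nA} G M b a =
  (∀ (a' : Fin nA) → M a' ≢ just b) ⊎
  (∃ λ a' → (M a' ≡ just b) × Before (prefB G b) a a')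

Blocking : ∀ {nA nB} → Instance nA nB → Matching nA nB → Fin nA → Fin nB → Set
Blocking G M a b =
  Edge G a b × (M a ≢ just b) × PrefA G M a b × PrefB G M b a

Stable : ∀ {nA nB} → Instance nA nB → Matching nA nB → Set
Stable G M = ∀ a b → ¬ Blocking G M a b

RelaxedStable : ∀ {nA nB} → Instance nA nB → Matching nA nB → Set
RelaxedStable G M =
  ∀ a b → Blocking G M a b → ∃ λ b' → (M a ≡ just b') × (lq G b' ≡ true)

Feasible : ∀ {nA nB} → Instance nA nB → Matching nA nB → Set
Feasible {nA} G M = ∀ b → lq G b ≡ true → ∃ λ (a : Fin nA) → M a ≡ just b

size : ∀ {n} {X : Set} → (Fin n → Maybe X) → ℕ
size {zero}  M = 0
size {suc n} M with M zero
... | just _  = suc (size {n} (λ i → M (suc i)))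
... | nothing = size {n} (λ i → M (suc i))

module _ {nA nB : ℕ} (G : Instance nA nB) (Ms : Matching nA nB) where

  private
    memB : Fin nB → List (Fin nB) → Bool
    memB x xs = does (DecMem._∈?_ _≟_ x xs)
    memA : Fin nA → List (Fin nA) → Bool
    memA x xs = does (DecMem._∈?_ _≟_ x xs)
    eqM : Maybe (Fin nB) → Fin nB → Bool
    eqM nothing  b = false
    eqM (just b') b = does (b' ≟ b)

  -- number of edges marked per matched vertex: take k = min(k , ℓ(v)) edges
  markCount : ℕ
  markCount = 2 * size Ms + 1

  matchedB : Fin nB → Bool
  matchedB b = any (λ a → eqM (Ms a) b) (allFin nA)

  marked : Fin nA → Fin nB → Bool
  marked a b =
    (is-just (Ms a) ∧ memB b (take markCount (prefA G a))) ∨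
    (matchedB b ∧ memA a (take markCount (prefB G b)))

  -- G' : marked edges, preference lists restricted; a resource belongs to
  -- G' iff it has a marked edge, and keeps its quota there.
  nonEmpty : ∀ {X : Set} → List X → Bool
  nonEmpty []      = false
  nonEmpty (_ ∷ _) = true

  G′ : Instance nA nB
  G′ = record
    { prefA = λ a → filterᵇ (λ b → marked a b) (prefA G a)
    ; prefB = λ b → filterᵇ (λ a → marked a b) (prefB G b)
    ; lq    = λ b → lq G b ∧ nonEmpty (filterᵇ (λ a → marked a b) (prefB G b))
    }

-- Every edge of G′ is an edge of G marked by a vertex matched in Ms, so M′ has at most 2s edges.
-- Let (a , b) block M′ in G with a not matched to an LQ resource.  If the edge is marked, it blocks
-- M′ in G′ too, contradicting relaxed stability there.  Otherwise, if b is matched in Ms, the 2s + 1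
-- agents b marked all rank above a, and each of them would block M′ in G′ together with b unless
-- matched in M′; if a is matched in Ms, symmetrically all 2s + 1 resources a marked must be matched
-- in M′.  Both exceed the bound 2s.  If neither a nor b is matched in Ms, (a , b) blocks Ms.
-- Feasibility survives because an LQ resource is matched in Ms, hence marks an edge and stays LQ.
module Submission where

open import Data.Nat using (ℕ; zero; suc; _+_; _≤_; _<_; z≤n; s≤s)
open import Data.Nat.Properties using (+-identityʳ; <-≤-trans; ≤-<-trans; <⇒≱; m≤m+n; m+n≮m; +-monoʳ-<; +-cancelˡ-≡; suc-injective; m<m+n)
open import Data.Fin using (Fin; zero; suc; toℕ; fromℕ<)
open import Data.Fin.Properties using (_≟_; any?; injective⇒≤; toℕ-fromℕ<)
open import Data.Bool using (Bool; true; false; T; T?; _∧_)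
open import Data.Bool.Properties using (T-∧; T-∨; ∧-identityʳ)
open import Data.Unit using (tt)
open import Data.Maybe using (Maybe; just; nothing; is-just)
open import Data.Maybe.Properties using (just-injective; ≡-dec)
open import Data.List using (List; []; _∷_; _++_; take; filterᵇ; allFin; length; lookup)
open import Data.List.Properties using (++-assoc; take++drop≡id)
open import Data.List.Membership.Propositional using (_∈_; _∉_; find)
open import Data.List.Membership.Propositional.Properties using (∈-filter⁺; ∈-filter⁻; ∈-++⁺ˡ; ∈-++⁺ʳ; ∈-++⁻; ∈-∃++; ∈-allFin; ∈-lookup)
open import Data.List.Relation.Unary.Any using (here; there)
open import Data.List.Relation.Unary.Any.Properties using (any⁺; any⁻)
open import Data.List.Relation.Unary.All.Properties using (¬Any⇒All¬)
import Data.List.Membership.DecPropositional as DecMem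
open import Data.List.Relation.Unary.All as All using ()
open import Data.List.Relation.Unary.Unique.Propositional using (Unique)
open import Data.List.Relation.Unary.Unique.Propositional.Properties using (take⁺)
open import Data.List.Relation.Unary.AllPairs using (_∷_)
open import Data.Product using (∃; ∃₂; _×_; _,_; proj₁; proj₂)
open import Data.Sum using (_⊎_; inj₁; inj₂)
open import Data.Empty using (⊥-elim)
open import Function.Bundles using (Equivalence)
open import Function using (_∘_)
open import Relation.Nullary using (¬_; Dec; does; yes; no)
open import Relation.Nullary.Decidable using (decidable-stable)
open import Relation.Binary.PropositionalEquality using (_≡_; _≢_; refl; sym; trans; cong; subst)
open import Defs

module _ {X : Set} where

  Before-∷ : ∀ {l : List X} {x y} w → Before l x y → Before (w ∷ l) x y
  Before-∷ w (xs , ys , refl , y∈ys) = w ∷ xs , ys , refl , y∈ys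

  Before-head : ∀ {l : List X} {y} w → y ∈ l → Before (w ∷ l) w y
  Before-head w y∈l = [] , _ , refl , y∈l

  Before-∷⁻ : ∀ {l : List X} {w x y} → Before (w ∷ l) x y → (x ≡ w × y ∈ l) ⊎ Before l x y
  Before-∷⁻ ([]     , ys , refl , y∈ys) = inj₁ (refl , y∈ys)
  Before-∷⁻ (_ ∷ xs , ys , refl , y∈ys) = inj₂ (xs , ys , refl , y∈ys)

  ¬Before-[] : ∀ {x y : X} → ¬ Before [] x y
  ¬Before-[] ([]    , _ , () , _)
  ¬Before-[] (_ ∷ _ , _ , () , _)

  Before⇒∈ʳ : ∀ {l : List X} {x y} → Before l x y → y ∈ l
  Before⇒∈ʳ (xs , ys , refl , y∈ys) = ∈-++⁺ʳ xs (there y∈ys)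

  Before-++ : ∀ {xs ys : List X} {x y} → x ∈ xs → y ∈ ys → Before (xs ++ ys) x y
  Before-++ {ys = ys} x∈xs y∈ys with us , vs , refl ← ∈-∃++ x∈xs =
    us , vs ++ ys , ++-assoc us (_ ∷ vs) ys , ∈-++⁺ʳ vs y∈ys

  Before-trans : ∀ {l : List X} {x y z} → Unique l → Before l x y → Before l y z → Before l x z
  Before-trans {[]} _ x<y _ = ⊥-elim (¬Before-[] x<y)
  Before-trans {w ∷ l} (w∉l ∷ u) x<y y<z with Before-∷⁻ x<y | Before-∷⁻ y<z
  ... | inj₁ (refl , y∈l) | inj₁ (refl , _)   = ⊥-elim (All.lookup w∉l y∈l refl)
  ... | inj₁ (refl , _)   | inj₂ y<z′         = Before-head w (Before⇒∈ʳ y<z′)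
  ... | inj₂ x<y′         | inj₁ (refl , _)   = ⊥-elim (All.lookup w∉l (Before⇒∈ʳ x<y′) refl)
  ... | inj₂ x<y′         | inj₂ y<z′         = Before-∷ w (Before-trans u x<y′ y<z′)

  Before-filter⁺ : ∀ (p : X → Bool) {l : List X} {x y} →
                   Before l x y → T (p x) → T (p y) → Before (filterᵇ p l) x y
  Before-filter⁺ p {[]} x<y _ _ = ⊥-elim (¬Before-[] x<y)
  Before-filter⁺ p {w ∷ l} x<y px py with Before-∷⁻ x<y
  ... | inj₁ (refl , y∈l) with p w
  ...   | true  = Before-head w (∈-filter⁺ {P = T ∘ p} (T? ∘ p) y∈l py)
  ...   | false = ⊥-elim px
  Before-filter⁺ p {w ∷ l} x<y px py | inj₂ x<y′ with p w
  ...   | true  = Before-∷ w (Before-filter⁺ p x<y′ px py)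
  ...   | false = Before-filter⁺ p x<y′ px py

  ∈-take⁻ : ∀ k {l : List X} {x} → x ∈ take k l → x ∈ l
  ∈-take⁻ k {l} x∈ = subst (_ ∈_) (take++drop≡id k l) (∈-++⁺ˡ x∈)

  Before-take : ∀ k {l : List X} {x y} → x ∈ take k l → y ∈ l → y ∉ take k l → Before l x y
  Before-take k {l} x∈ y∈l y∉ with ∈-++⁻ (take k l) (subst (_ ∈_) (sym (take++drop≡id k l)) y∈l)
  ... | inj₁ y∈ = ⊥-elim (y∉ y∈)
  ... | inj₂ y∈drop = subst (λ l′ → Before l′ _ _) (take++drop≡id k l) (Before-++ x∈ y∈drop)

  ∃∈-take : ∀ {n} {l : List X} {x} → 0 < n → x ∈ l → ∃ λ y → y ∈ take n l
  ∃∈-take {l = y ∷ _} (s≤s _) _ = y , here refl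

  length-take-≡ : ∀ k {l : List X} {y} → y ∈ l → y ∉ take k l → length (take k l) ≡ k
  length-take-≡ zero    _           _  = refl
  length-take-≡ (suc k) (here refl) y∉ = ⊥-elim (y∉ (here refl))
  length-take-≡ (suc k) (there y∈l) y∉ = cong suc (length-take-≡ k y∈l (y∉ ∘ there))

lookup-injective : ∀ {X : Set} {xs : List X} → Unique xs → ∀ i j → lookup xs i ≡ lookup xs j → i ≡ j
lookup-injective {xs = _ ∷ _} _ zero zero _ = refl
lookup-injective {xs = _ ∷ xs} (x∉xs ∷ _) zero (suc j) eq = ⊥-elim (All.lookup x∉xs (∈-lookup {xs = xs} j) eq)
lookup-injective {xs = _ ∷ xs} (x∉xs ∷ _) (suc i) zero eq = ⊥-elim (All.lookup x∉xs (∈-lookup {xs = xs} i) (sym eq))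
lookup-injective {xs = _ ∷ _} (_ ∷ u) (suc i) (suc j) eq = cong suc (lookup-injective u i j eq)

length≤-byInjectiveCode : ∀ {X : Set} {xs : List X} (m : ℕ) (Code : X → ℕ → Set) → Unique xs →
                          (∀ {x} → x ∈ xs → ∃ λ n → n < m × Code x n) →
                          (∀ {x y n} → Code x n → Code y n → x ≡ y) → length xs ≤ m
length≤-byInjectiveCode {xs = xs} m Code u code code-injective = injective⇒≤ {f = f} f-injective
  where
  f : Fin (length xs) → Fin m
  f i = fromℕ< (proj₁ (proj₂ (code (∈-lookup {xs = xs} i))))

  f-injective : ∀ {i j} → f i ≡ f j → i ≡ j
  f-injective {i} {j} fi≡fj with code (∈-lookup {xs = xs} i) | code (∈-lookup {xs = xs} j)
  ... | n , n<m , ci | n′ , n′<m , cj = lookup-injective u i j (code-injective ci (subst (Code _) (sym n≡n′) cj))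
    where
    n≡n′ : n ≡ n′
    n≡n′ = trans (sym (toℕ-fromℕ< n<m)) (trans (cong toℕ fi≡fj) (toℕ-fromℕ< n′<m))

rank : ∀ {n} {X : Set} → (Fin n → Maybe X) → Fin n → ℕ
rank M zero = 0
rank M (suc i) with M zero
... | just _  = suc (rank (M ∘ suc) i)
... | nothing = rank (M ∘ suc) i

rank<size : ∀ {n} {X : Set} (M : Fin n → Maybe X) i {x} → M i ≡ just x → rank M i < size M
rank<size M zero Mi≡x with M zero
rank<size M zero refl | just _ = s≤s z≤n
rank<size M (suc i) Mi≡x with M zero
... | just _  = s≤s (rank<size (M ∘ suc) i Mi≡x)
... | nothing = rank<size (M ∘ suc) i Mi≡x

rank-injective : ∀ {n} {X : Set} (M : Fin n → Maybe X) i j {x y} → M i ≡ just x → M j ≡ just y →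
                 rank M i ≡ rank M j → i ≡ j
rank-injective M zero zero _ _ _ = refl
rank-injective M zero (suc j) Mi≡x _ r with M zero
rank-injective M zero (suc j) refl _ () | just _
rank-injective M (suc i) zero _ Mj≡y r with M zero
rank-injective M (suc i) zero _ refl () | just _
rank-injective M (suc i) (suc j) Mi≡x Mj≡y r with M zero
... | just _  = cong suc (rank-injective (M ∘ suc) i j Mi≡x Mj≡y (suc-injective r))
... | nothing = cong suc (rank-injective (M ∘ suc) i j Mi≡x Mj≡y r)

T-does⁺ : ∀ {A : Set} (a? : Dec A) → A → T (does a?)
T-does⁺ (yes _) _ = tt
T-does⁺ (no ¬a) a = ¬a a

T-does⁻ : ∀ {A : Set} (a? : Dec A) → T (does a?) → A
T-does⁻ (yes a) _ = a

PrefA-Before : ∀ {nA nB} {G : Instance nA nB} {M a b b″} → WellFormed G →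
               Before (prefA G a) b″ b → PrefA G M a b → PrefA G M a b″
PrefA-Before _  _    (inj₁ unmatched) = inj₁ unmatched
PrefA-Before wf b″<b (inj₂ (b′ , Ma≡b′ , b<b′)) = inj₂ (b′ , Ma≡b′ , Before-trans (WellFormed.uniqA wf _) b″<b b<b′)

PrefB-Before : ∀ {nA nB} {G : Instance nA nB} {M b a a″} → WellFormed G →
               Before (prefB G b) a″ a → PrefB G M b a → PrefB G M b a″
PrefB-Before _  _    (inj₁ unmatched) = inj₁ unmatched
PrefB-Before wf a″<a (inj₂ (a′ , Ma′≡b , a<a′)) = inj₂ (a′ , Ma′≡b , Before-trans (WellFormed.uniqB wf _) a″<a a<a′)

≡nothing⇒≢just : ∀ {A : Set} {m : Maybe A} {x} → m ≡ nothing → m ≢ just x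
≡nothing⇒≢just refl ()

MatchedToLQ : ∀ {nA nB} → Instance nA nB → Matching nA nB → Fin nA → Set
MatchedToLQ G M a = ∃ λ b → M a ≡ just b × lq G b ≡ true

MatchedToLQ? : ∀ {nA nB} (G : Instance nA nB) (M : Matching nA nB) a → Dec (MatchedToLQ G M a)
MatchedToLQ? G M a with M a
... | nothing = no λ ()
... | just b with lq G b in lq-b
...   | true  = yes (b , refl , lq-b)
...   | false = no λ { (_ , refl , lq-b′) → false≢true (trans (sym lq-b) lq-b′) }
  where
  false≢true : false ≢ true
  false≢true ()

module Marking {nA nB : ℕ} (G : Instance nA nB) (Ms : Matching nA nB) where

  s k : ℕ
  s = size Ms
  k = markCount G Ms

  Marked : Fin nA → Fin nB → Set
  Marked a b = T (marked G Ms a b)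

  2s<k : s + s < k
  2s<k rewrite +-identityʳ s = m<m+n (s + s) (s≤s z≤n)

  matchedB⁺ : ∀ {b c} → Ms c ≡ just b → T (matchedB G Ms b)
  matchedB⁺ {b} {c} Msc≡b with T? (matchedB G Ms b)
  ... | yes t = t
  ... | no ¬t with Ms c | Msc≡b | All.lookup (¬Any⇒All¬ _ (¬t ∘ any⁺ _)) (∈-allFin c)
  ...   | _ | refl | ¬Msc≡b = ⊥-elim (¬Msc≡b (T-does⁺ (b ≟ b) refl))

  matchedB⁻ : ∀ {b} → T (matchedB G Ms b) → ∃ λ c → Ms c ≡ just b
  matchedB⁻ {b} t with find (any⁻ _ (allFin nA) t)
  ... | c , _ , Msc≡b with Ms c in eq | Msc≡b
  ...   | just b′ | b′≡b = c , trans eq (cong just (T-does⁻ (b′ ≟ b) b′≡b))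

  private
    _∈?_ : ∀ {n} (x : Fin n) (xs : List (Fin n)) → Dec (x ∈ xs)
    _∈?_ = DecMem._∈?_ _≟_

    markedByAgent markedByResource : Fin nA → Fin nB → Bool
    markedByAgent a b = is-just (Ms a) ∧ does (b ∈? take k (prefA G a))
    markedByResource a b = matchedB G Ms b ∧ does (a ∈? take k (prefB G b))

  Marked-byAgent : ∀ {a b x} → Ms a ≡ just x → b ∈ take k (prefA G a) → Marked a b
  Marked-byAgent {a} {b} Msa≡x b∈ =
    Equivalence.from (T-∨ {markedByAgent a b}) (inj₁ (Equivalence.from (T-∧ {is-just (Ms a)})
      (subst (T ∘ is-just) (sym Msa≡x) tt , T-does⁺ (b ∈? _) b∈)))

  Marked-byResource : ∀ {a b} → T (matchedB G Ms b) → a ∈ take k (prefB G b) → Marked a b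
  Marked-byResource {a} {b} matched a∈ =
    Equivalence.from (T-∨ {markedByAgent a b}) (inj₂ (Equivalence.from (T-∧ {matchedB G Ms b})
      (matched , T-does⁺ (a ∈? _) a∈)))

  Marked⇒matched : ∀ {a b} → Marked a b → (∃ λ x → Ms a ≡ just x) ⊎ T (matchedB G Ms b)
  Marked⇒matched {a} {b} m with Equivalence.to (T-∨ {markedByAgent a b}) m
  ... | inj₁ byAgent with Ms a | proj₁ (Equivalence.to (T-∧ {is-just (Ms a)}) byAgent)
  ...   | just x | _ = inj₁ (x , refl)
  Marked⇒matched m | inj₂ byResource = inj₂ (proj₁ (Equivalence.to (T-∧ {matchedB G Ms _}) byResource))

  Edge-G′⁻ : ∀ {a b} → Edge (G′ G Ms) a b → Edge G a b × Marked a b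
  Edge-G′⁻ {a} {b} (b∈ , a∈) with ∈-filter⁻ {P = Marked a} (T? ∘ marked G Ms a) b∈
                              | ∈-filter⁻ {P = λ x → Marked x b} (λ x → T? (marked G Ms x b)) a∈
  ... | b∈G , marked-ab | a∈G , _ = (b∈G , a∈G) , marked-ab

  Edge-G′⁺ : ∀ {a b} → Edge G a b → Marked a b → Edge (G′ G Ms) a b
  Edge-G′⁺ {a} {b} (b∈ , a∈) marked-ab =
    ∈-filter⁺ {P = Marked a} (T? ∘ marked G Ms a) b∈ marked-ab ,
    ∈-filter⁺ {P = λ x → Marked x b} (λ x → T? (marked G Ms x b)) a∈ marked-ab

  module _ {M : Matching nA nB} (isM : IsMatching (G′ G Ms) M) where

    matched⇒Marked : ∀ {a b} → M a ≡ just b → Marked a b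
    matched⇒Marked Ma≡b = proj₂ (Edge-G′⁻ (proj₁ isM _ _ Ma≡b))

    PrefA-G′⁺ : ∀ {a b} → Marked a b → PrefA G M a b → PrefA (G′ G Ms) M a b
    PrefA-G′⁺ _ (inj₁ unmatched) = inj₁ unmatched
    PrefA-G′⁺ {a} marked-ab (inj₂ (b′ , Ma≡b′ , b<b′)) =
      inj₂ (b′ , Ma≡b′ , Before-filter⁺ (marked G Ms a) b<b′ marked-ab (matched⇒Marked Ma≡b′))

    PrefB-G′⁺ : ∀ {a b} → Marked a b → PrefB G M b a → PrefB (G′ G Ms) M b a
    PrefB-G′⁺ _ (inj₁ unmatched) = inj₁ unmatched
    PrefB-G′⁺ {b = b} marked-ab (inj₂ (a′ , Ma′≡b , a<a′)) =
      inj₂ (a′ , Ma′≡b , Before-filter⁺ (λ x → marked G Ms x b) a<a′ marked-ab (matched⇒Marked Ma′≡b))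

    Blocking-G′⁺ : ∀ {a b} → Marked a b → Blocking G M a b → Blocking (G′ G Ms) M a b
    Blocking-G′⁺ marked-ab (edge , Ma≢b , prefA , prefB) =
      Edge-G′⁺ edge marked-ab , Ma≢b , PrefA-G′⁺ marked-ab prefA , PrefB-G′⁺ marked-ab prefB

    -- An edge of M marked by an agent matched in Ms is coded by the rank of that agent, one marked
    -- by a resource matched in Ms by s plus the rank of the resource's Ms-partner.
    Code : Fin nA → ℕ → Set
    Code a n = (∃ λ x → Ms a ≡ just x × n ≡ rank Ms a)
             ⊎ (∃₂ λ c b → M a ≡ just b × Ms c ≡ just b × n ≡ s + rank Ms c)

    code : ∀ {a b} → M a ≡ just b → ∃ λ n → n < s + s × Code a n
    code {a} Ma≡b with Marked⇒matched (matched⇒Marked Ma≡b)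
    ... | inj₁ (x , Msa≡x) = rank Ms a , <-≤-trans (rank<size Ms a Msa≡x) (m≤m+n s s) , inj₁ (x , Msa≡x , refl)
    ... | inj₂ b∈XB with matchedB⁻ b∈XB
    ...   | c , Msc≡b = s + rank Ms c , +-monoʳ-< s (rank<size Ms c Msc≡b) , inj₂ (c , _ , Ma≡b , Msc≡b , refl)

    code-injective : ∀ {a a′ n} → Code a n → Code a′ n → a ≡ a′
    code-injective {a} {a′} (inj₁ (_ , Msa≡x , refl)) (inj₁ (_ , Msa′≡y , r)) = rank-injective Ms a a′ Msa≡x Msa′≡y r
    code-injective (inj₁ (_ , Msa≡x , refl)) (inj₂ (_ , _ , _ , _ , r)) =
      ⊥-elim (m+n≮m s _ (subst (_< s) r (rank<size Ms _ Msa≡x)))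
    code-injective (inj₂ (_ , _ , _ , _ , refl)) (inj₁ (_ , Msa′≡y , r)) =
      ⊥-elim (m+n≮m s _ (subst (_< s) (sym r) (rank<size Ms _ Msa′≡y)))
    code-injective {a} {a′} (inj₂ (c , b , Ma≡b , Msc≡b , refl)) (inj₂ (c′ , b′ , Ma′≡b′ , Msc′≡b′ , r)) =
      proj₂ isM a a′ b Ma≡b (subst (λ x → M a′ ≡ just x) (sym b≡b′) Ma′≡b′)
      where
      c≡c′ : c ≡ c′
      c≡c′ = rank-injective Ms c c′ Msc≡b Msc′≡b′ (+-cancelˡ-≡ s _ _ r)
      b≡b′ : b ≡ b′
      b≡b′ = just-injective (trans (sym Msc≡b) (trans (cong Ms c≡c′) Msc′≡b′))

    matchedAgents-length≤ : ∀ {as} → Unique as → (∀ {a} → a ∈ as → ∃ λ b → M a ≡ just b) → length as ≤ s + s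
    matchedAgents-length≤ u matched = length≤-byInjectiveCode (s + s) Code u (code ∘ proj₂ ∘ matched) code-injective

    matchedResources-length≤ : ∀ {bs} → Unique bs → (∀ {b} → b ∈ bs → ∃ λ a → M a ≡ just b) → length bs ≤ s + s
    matchedResources-length≤ u matched =
      length≤-byInjectiveCode (s + s) (λ b n → ∃ λ a → M a ≡ just b × Code a n) u
        (λ b∈ → let a , Ma≡b = matched b∈ ; n , n<2s , c = code Ma≡b in n , n<2s , a , Ma≡b , c)
        (λ (a , Ma≡b , c) (a′ , Ma′≡b′ , c′) →
          just-injective (trans (sym Ma≡b) (trans (cong M (code-injective c c′)) Ma′≡b′)))

  MatchedToLQ-G′⇒ : ∀ {M a} → MatchedToLQ (G′ G Ms) M a → MatchedToLQ G M a
  MatchedToLQ-G′⇒ (b , Ma≡b , lq′-b) = b , Ma≡b , lq-G′⇒ lq′-b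
    where
    lq-G′⇒ : ∀ {b} → lq (G′ G Ms) b ≡ true → lq G b ≡ true
    lq-G′⇒ {b} lq′-b with lq G b | lq′-b
    ... | true | _ = refl

  lq-G′ : ∀ {b c} → Ms c ≡ just b → c ∈ prefB G b → lq (G′ G Ms) b ≡ lq G b
  lq-G′ {b} Msc≡b c∈ with ∃∈-take (≤-<-trans z≤n 2s<k) c∈
  ... | a , a∈top with filterᵇ (λ x → marked G Ms x b) (prefB G b)
                     | ∈-filter⁺ {P = λ x → Marked x b} (λ x → T? (marked G Ms x b)) (∈-take⁻ k a∈top)
                                 (Marked-byResource (matchedB⁺ Msc≡b) a∈top)
  ...   | _ ∷ _ | _ = ∧-identityʳ (lq G b)

  IsMatching-G′⇒ : ∀ {M} → IsMatching (G′ G Ms) M → IsMatching G M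
  IsMatching-G′⇒ (edge′ , injective) = (λ a b Ma≡b → proj₁ (Edge-G′⁻ (edge′ a b Ma≡b))) , injective

  Feasible-G′⇒ : ∀ {M} → IsMatching G Ms → Feasible G Ms → Feasible (G′ G Ms) M → Feasible G M
  Feasible-G′⇒ (Ms-edge , _) Ms-feasible M-feasible b lq-b with Ms-feasible b lq-b
  ... | c , Msc≡b = M-feasible b (trans (lq-G′ Msc≡b (proj₂ (Ms-edge c b Msc≡b))) lq-b)

  module _ (wf : WellFormed G) (Ms-stable : Stable G Ms) {M : Matching nA nB}
           (M-matching : IsMatching (G′ G Ms) M) (M-rstable : RelaxedStable (G′ G Ms) M) where

    open WellFormed wf

    agentsAbove-matched : ∀ {a b a″} → Blocking G M a b → T (matchedB G Ms b) →
                          a″ ∈ take k (prefB G b) → a ∉ take k (prefB G b) → ∃ λ b″ → M a″ ≡ just b″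
    agentsAbove-matched {a} {b} {a″} ((_ , a∈) , _ , _ , b-prefers-a) b∈XB a″∈top a∉top with M a″ in Ma″
    ... | just b″ = b″ , refl
    ... | nothing = ⊥-elim (≡nothing⇒≢just Ma″ (proj₁ (proj₂ (M-rstable a″ b blocking))))
      where
      a″∈ : a″ ∈ prefB G b
      a″∈ = ∈-take⁻ k a″∈top
      marked-a″b : Marked a″ b
      marked-a″b = Marked-byResource b∈XB a″∈top
      blocking : Blocking (G′ G Ms) M a″ b
      blocking = Edge-G′⁺ (symBA a″ b a″∈ , a″∈) marked-a″b , ≡nothing⇒≢just Ma″ , inj₁ Ma″ ,
                 PrefB-G′⁺ M-matching marked-a″b (PrefB-Before {M = M} wf (Before-take k a″∈top a∈ a∉top) b-prefers-a)

    resourcesAbove-matched : ∀ {a b b″ x} → ¬ MatchedToLQ G M a → Blocking G M a b → Ms a ≡ just x →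
                             b″ ∈ take k (prefA G a) → b ∉ take k (prefA G a) → ∃ λ a″ → M a″ ≡ just b″
    resourcesAbove-matched {a} {b} {b″} ¬lq ((b∈ , _) , _ , a-prefers-b , _) Msa≡x b″∈top b∉top
      with any? (λ a″ → ≡-dec _≟_ (M a″) (just b″))
    ... | yes matched = matched
    ... | no unmatched = ⊥-elim (¬lq (MatchedToLQ-G′⇒ {M} (M-rstable a b″ blocking)))
      where
      b″∈ : b″ ∈ prefA G a
      b″∈ = ∈-take⁻ k b″∈top
      marked-ab″ : Marked a b″
      marked-ab″ = Marked-byAgent Msa≡x b″∈top
      blocking : Blocking (G′ G Ms) M a b″
      blocking = Edge-G′⁺ (b″∈ , symAB a b″ b″∈) marked-ab″ , (λ Ma≡b″ → unmatched (a , Ma≡b″)) ,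
                 PrefA-G′⁺ M-matching marked-ab″ (PrefA-Before {M = M} wf (Before-take k b″∈top b∈ b∉top) a-prefers-b) ,
                 inj₁ (λ a′ Ma′≡b″ → unmatched (a′ , Ma′≡b″))

    unmarkedBlocking-resourceMatched : ∀ {a b} → Blocking G M a b → ¬ Marked a b → ¬ T (matchedB G Ms b)
    unmarkedBlocking-resourceMatched {a} {b} blocking@((_ , a∈) , _) ¬marked b∈XB =
      <⇒≱ 2s<k (subst (_≤ s + s) (length-take-≡ k a∈ a∉top)
        (matchedAgents-length≤ M-matching (take⁺ k (uniqB b))
          (λ a″∈top → agentsAbove-matched blocking b∈XB a″∈top a∉top)))
      where
      a∉top : a ∉ take k (prefB G b)
      a∉top = ¬marked ∘ Marked-byResource b∈XB

    unmarkedBlocking-agentMatched : ∀ {a b x} → ¬ MatchedToLQ G M a → Blocking G M a b → ¬ Marked a b →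
                                    Ms a ≢ just x
    unmarkedBlocking-agentMatched {a} {b} ¬lq blocking@((b∈ , _) , _) ¬marked Msa≡x =
      <⇒≱ 2s<k (subst (_≤ s + s) (length-take-≡ k b∈ b∉top)
        (matchedResources-length≤ M-matching (take⁺ k (uniqA a))
          (λ b″∈top → resourcesAbove-matched ¬lq blocking Msa≡x b″∈top b∉top)))
      where
      b∉top : b ∉ take k (prefA G a)
      b∉top = ¬marked ∘ Marked-byAgent Msa≡x

    ¬Blocking : ∀ {a b} → ¬ MatchedToLQ G M a → ¬ Blocking G M a b
    ¬Blocking {a} {b} ¬lq blocking with T? (marked G Ms a b) | T? (matchedB G Ms b) | Ms a in Msa
    ... | yes marked-ab | _ | _ = ¬lq (MatchedToLQ-G′⇒ {M} (M-rstable a b (Blocking-G′⁺ M-matching marked-ab blocking)))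
    ... | no ¬marked | yes b∈XB | _ = unmarkedBlocking-resourceMatched blocking ¬marked b∈XB
    ... | no ¬marked | no _ | just x = unmarkedBlocking-agentMatched ¬lq blocking ¬marked Msa
    ... | no _ | no b∉XB | nothing =
      Ms-stable a b (proj₁ blocking , ≡nothing⇒≢just Msa , inj₁ Msa , inj₁ λ c Msc≡b → b∉XB (matchedB⁺ Msc≡b))

    RelaxedStable-G′⇒ : RelaxedStable G M
    RelaxedStable-G′⇒ a b blocking = decidable-stable (MatchedToLQ? G M a) (λ ¬lq → ¬Blocking ¬lq blocking)

lemma5 : ∀ {nA nB : ℕ} (G : Instance nA nB) → WellFormed G →
         (Ms : Matching nA nB) → IsMatching G Ms → Stable G Ms → Feasible G Ms →
         (M′ : Matching nA nB) → IsMatching (G′ G Ms) M′ →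
         Feasible (G′ G Ms) M′ → RelaxedStable (G′ G Ms) M′ →
         IsMatching G M′ × Feasible G M′ × RelaxedStable G M′
lemma5 G wf Ms Ms-matching Ms-stable Ms-feasible M′ M′-matching M′-feasible M′-rstable =
  IsMatching-G′⇒ M′-matching ,
  Feasible-G′⇒ Ms-matching Ms-feasible M′-feasible ,
  RelaxedStable-G′⇒ wf Ms-stable M′-matching M′-rstable
  where open Marking G Ms
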